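{- Let $C$ be a dendritic face complex. There is no (non-trivial) upper path between two sources of a common cell: there do not exist $d\in C$ and $e,e'\in\delta(d)$ with $e<^+e'$.
   Context: A positive-to-one poset (POP) is a finite set $P$ with $\dim:P\to\mathbb{N}$ and binary relations $\prec^-,\prec^+$; $y\prec x$ means $y\prec^-x$ or $y\prec^+x$. Axioms: $y\prec x\Rightarrow\dim x=\dim y+1$; never both $y\prec^-x$ and $y\prec^+x$; every $x$ with $\dim x\ge1$ has exactly one $y$ with $y\prec^+x$, denoted $\gamma(x)$, and at least one $y$ with $y\prec^-x$. $\delta(x)=\{y:y\prec^-x\}$, $C_k=\dim^{ -1}(k)$; $\le$ is the reflexive-transitive closure of $\prec$. A dendritic face complex is a POP such that: it has a greatest element for $\le$; (oriented thinness) whenever $z\prec^{\beta}y\prec^{\alpha}x$ there is a unique $y'\ne y$ with $z\prec y'\prec x$, and writing $z\prec^{\beta'}y'\prec^{\alpha'}x$ the signs (as $\pm1$) satisfy $\alpha\beta=-\alpha'\beta'$; (acyclicity) $\delta(x)$ is a singleton if $\dim x=1$, nonempty if $\dim x\ge1$, and for $\dim x\ge1$ there are no $p\ge1$, $y_1,\dots,y_p\in\delta(x)$ with $\gamma(y_{i+1})\in\delta(y_i)$ ($1\le i<p$) and $\gamma(y_1)\in\delta(y_p)$. For $a,b\in C_k$, $a\triangleleft^+b$ iff there is $c\in C_{k+1}$ with $a\prec^-c$ and $b=\gamma(c)$; $<^+$ is the transitive closure of $\triangleleft^+$ (so $e<^+e'$ means there is an upper path $e=e_0\triangleleft^+e_1\triangleleft^+\cdots\triangleleft^+e_p=e'$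 with $p\ge1$). -}

module Defs where

open import Data.Nat using (ℕ; zero; suc; _+_; _≥_)
open import Data.Fin using (Fin; inject₁; fromℕ) renaming (suc to fsuc; zero to fzero)
open import Data.Product using (Σ; ∃; ∃-syntax; _×_; _,_; proj₁)
open import Data.Empty using (⊥)
open import Relation.Nullary using (¬_)
open import Relation.Binary.PropositionalEquality using (_≡_; _≢_)
open import Relation.Binary.Construct.Closure.ReflexiveTransitive using (Star)
open import Relation.Binary.Construct.Closure.Transitive using (TransClosure)

-- Orientation signs: ⁻ is -1, ⁺ is +1.
data Sign : Set where
  ⁻ ⁺ : Sign

_·_ : Sign → Sign → Sign
⁻ · ⁻ = ⁺
⁻ · ⁺ = ⁻
⁺ · ⁻ = ⁻
⁺ · ⁺ = ⁺

neg : Sign → Sign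
neg ⁻ = ⁺
neg ⁺ = ⁻

-- A positive-to-one poset on the finite carrier Fin n.
-- rel ⁻ y x  means  y ≺⁻ x ;  rel ⁺ y x  means  y ≺⁺ x.
record POP (n : ℕ) : Set₁ where
  field
    dim : Fin n → ℕ
    rel : Sign → Fin n → Fin n → Set
    rel-dim : ∀ {α} y x → rel α y x → dim x ≡ suc (dim y)
    rel-excl : ∀ y x → rel ⁻ y x → rel ⁺ y x → ⊥
    pos-exists : ∀ x → dim x ≥ 1 → Σ (Fin n) λ y → rel ⁺ y x × (∀ z → rel ⁺ z x → z ≡ y)
    neg-exists : ∀ x → dim x ≥ 1 → ∃[ y ] rel ⁻ y x

  _≺_ : Fin n → Fin n → Set
  y ≺ x = Σ Sign λ α → rel α y x

  _≤ᶜ_ : Fin n → Fin n → Set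
  _≤ᶜ_ = Star _≺_

  γ : (x : Fin n) → dim x ≥ 1 → Fin n
  γ x h = proj₁ (pos-exists x h)

  _∈δ_ : Fin n → Fin n → Set
  y ∈δ x = rel ⁻ y x

  _◁⁺_ : Fin n → Fin n → Set
  a ◁⁺ b = Σ (Fin n) λ c → Σ (dim c ≥ 1) λ h → rel ⁻ a c × b ≡ γ c h

  _<⁺_ : Fin n → Fin n → Set
  _<⁺_ = TransClosure _◁⁺_

record IsDendritic {n : ℕ} (P : POP n) : Set where
  open POP P
  field
    greatest : Σ (Fin n) λ t → ∀ x → x ≤ᶜ t
    thin : ∀ {α β} x y z → rel β z y → rel α y x →
           Σ (Fin n) λ y' → y' ≢ y ×
             (Σ Sign λ β' → Σ Sign λ α' → rel β' z y' × rel α' y' x × (α · β) ≡ neg (α' · β'))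
             × (∀ y'' → y'' ≢ y → z ≺ y'' → y'' ≺ x → y'' ≡ y')
    δ-singleton : ∀ x → dim x ≡ 1 → ∀ y y' → rel ⁻ y x → rel ⁻ y' x → y ≡ y'
    δ-nonempty : ∀ x → dim x ≥ 1 → ∃[ y ] rel ⁻ y x
    acyclic : ∀ x → dim x ≥ 1 → (p : ℕ) → (ys : Fin (suc p) → Fin n) →
              (inδ : ∀ i → rel ⁻ (ys i) x) →
              (hd : ∀ i → dim (ys i) ≥ 1) →
              ¬ ((∀ (i : Fin p) → rel ⁻ (γ (ys (fsuc i)) (hd (fsuc i))) (ys (inject₁ i)))
                 × rel ⁻ (γ (ys fzero) (hd fzero)) (ys (fromℕ p)))

-- Work downwards from the greatest cell.  Fix Z of dimension L + 2 and suppose there are no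
-- upper cycles in dimension L + 1.  Every cell c of dimension L + 1 then expands into the inputs
-- of Z: some ℕ-weighted chain M on δZ has ∂M = ∂c.  Inputs of Z expand trivially; an output γx
-- expands as the sum of the expansions of the inputs of x, because ∂∂x = 0 by oriented thinness,
-- and this recursion along upper paths is well-founded by the no-cycle assumption.  (For this
-- we also need that each such c is an input of Z or an output; this passes from Z to γZ through
-- the expansions.)  Now an upper path from e to e′ with e, e′ ∈ δd and dim e = L sums to a chain
-- on δZ of boundary ≤ e′ − e; adding the expansion of d gives boundary ≤ γd − 2e when e ≠ e′.
-- Either way some input of Z carries positive mass that must move on through its output into a
-- further input of Z, and so on indefinitely, against acyclicity of δZ.  This rules out such
-- paths, and in particular upper cycles, in dimension L, which starts the next level down.
-- Counting needs decidable face relations; classically they are, and the goal is a negation.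

module Submission where

open import Defs
open import Data.Nat using (ℕ; zero; suc; _+_; _*_; _∸_; _≤_; _<_; _≥_; z≤n; s≤s; _<?_)
open import Data.Nat.Properties
open import Data.Fin using (Fin; inject₁; fromℕ; punchIn) renaming (zero to fzero; suc to fsuc; _≟_ to _≟ᶠ_)
open import Data.Fin.Properties using (punchInᵢ≢i; sequence; any?)
open import Data.Fin.Induction using (spo-wellFounded)
open import Data.Vec.Functional using (removeAt; replicate) renaming (_∷_ to _∷ᵥ_)
open import Data.Product using (Σ; ∃-syntax; _×_; _,_; proj₁; proj₂)
open import Data.Sum using (_⊎_; inj₁; inj₂)
open import Data.Empty using (⊥; ⊥-elim)
open import Data.Unit using (⊤; tt)
open import Effect.Monad using (RawMonad)
open import Function using (_∘_)
open import Level using (0ℓ)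
open import Induction.WellFounded using (WellFounded; Acc; acc)
open import Relation.Binary.Core using (Rel)
open import Relation.Binary.Structures using (IsStrictPartialOrder)
open import Relation.Nullary using (¬_; Dec; yes; no; contradiction)
open import Relation.Nullary.Decidable using (¬¬-excluded-middle)
open import Relation.Nullary.Negation using (¬¬-Monad; ¬¬-map)
open import Relation.Binary.PropositionalEquality
  using (_≡_; _≢_; _≗_; refl; sym; trans; cong; cong₂; subst; subst₂; isEquivalence; resp₂; module ≡-Reasoning)
open import Relation.Binary.Construct.Closure.ReflexiveTransitive using (ε; _◅_)
open import Relation.Binary.Construct.Closure.Transitive using (TransClosure; [_]; _∷_; _++_; wellFounded⁻)
open import Data.Nat.Tactic.RingSolver using (solve-∀)
open import Algebra.Properties.CommutativeSemigroup +-commutativeSemigroup using (interchange)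
open import Algebra.Properties.Semiring.Sum +-*-semiring
  using (sum; sum-syntax; ∑-distrib-+; sum-cong-≗; sum-remove; sum-replicate-zero)

+-positive : ∀ {m n} → 0 < m + n → 0 < m ⊎ 0 < n
+-positive {zero}  pos = inj₂ pos
+-positive {suc m} _   = inj₁ (s≤s z≤n)

*-positive : ∀ m {n} → 0 < m * n → 0 < m × 0 < n
*-positive (suc m) {zero}  pos = contradiction (subst (0 <_) (*-zeroʳ (suc m)) pos) (λ ())
*-positive (suc m) {suc n} _   = s≤s z≤n , s≤s z≤n

≯0⇒≡0 : ∀ {m} → ¬ 0 < m → m ≡ 0
≯0⇒≡0 = n<1⇒n≡0 ∘ ≰⇒>

balanced-trans : ∀ {a a′ b b′ c c′} → a + b′ ≡ a′ + b → b + c′ ≡ b′ + c → a + c′ ≡ a′ + c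
balanced-trans {a} {a′} {b} {b′} {c} {c′} p q = +-cancelʳ-≡ (b′ + b) (a + c′) (a′ + c) (begin
  (a + c′) + (b′ + b)   ≡⟨ shuffle a c′ b′ b ⟩
  (a + b′) + (b + c′)   ≡⟨ cong₂ _+_ p q ⟩
  (a′ + b) + (b′ + c)   ≡⟨ shuffle a′ c b b′ ⟨
  (a′ + c) + (b + b′)   ≡⟨ cong ((a′ + c) +_) (+-comm b b′) ⟩
  (a′ + c) + (b′ + b)   ∎)
  where
  open ≡-Reasoning
  shuffle : ∀ x y z w → (x + y) + (z + w) ≡ (x + z) + (w + y)
  shuffle = solve-∀

∑-positive : ∀ {m} (f : Fin m → ℕ) → 0 < ∑[ i < m ] f i → ∃[ i ] 0 < f i
∑-positive {suc m} f pos with +-positive {f fzero} pos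
... | inj₁ pos₀ = fzero , pos₀
... | inj₂ pos₁ = let (i , posᵢ) = ∑-positive (f ∘ fsuc) pos₁ in fsuc i , posᵢ

term≤∑ : ∀ {m} (f : Fin m → ℕ) i → f i ≤ ∑[ j < m ] f j
term≤∑ {suc m} f i = ≤-trans (m≤m+n (f i) _) (≤-reflexive (sym (sum-remove {i = i} f)))

∑-unique-positive : ∀ {m} (f : Fin m → ℕ) i → (∀ j → 0 < f j → j ≡ i) → ∑[ j < m ] f j ≡ f i
∑-unique-positive {suc m} f i unique = begin
  sum f                     ≡⟨ sum-remove {i = i} f ⟩
  f i + sum (removeAt f i)  ≡⟨ cong (f i +_) (trans (sum-cong-≗ vanishes) (sum-replicate-zero m)) ⟩
  f i + 0                   ≡⟨ +-identityʳ (f i) ⟩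
  f i                       ∎
  where
  open ≡-Reasoning
  vanishes : removeAt f i ≗ replicate m 0
  vanishes j = ≯0⇒≡0 (λ pos → punchInᵢ≢i i j (unique (punchIn i j) pos))

module _ {n ℓ} {R : Rel (Fin n) ℓ} where

  acyclic⇒wellFounded : (∀ {x} → ¬ TransClosure R x x) → WellFounded R
  acyclic⇒wellFounded acyclic = wellFounded⁻ R (spo-wellFounded isSPO)
    where
    isSPO : IsStrictPartialOrder _≡_ (TransClosure R)
    isSPO = record
      { isEquivalence = isEquivalence
      ; irrefl        = λ { refl → acyclic }
      ; trans         = _++_
      ; <-resp-≈      = resp₂ (TransClosure R)
      }

module _ {a ℓ} {A : Set a} {R : Rel A ℓ} where

  ⁺-head : ∀ {x y} → TransClosure R x y → ∃[ z ] R x z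
  ⁺-head [ r ]   = _ , r
  ⁺-head (r ∷ _) = _ , r

  ⁺-last : ∀ {x y} → TransClosure R x y → ∃[ z ] R z y
  ⁺-last [ r ]    = _ , r
  ⁺-last (_ ∷ rs) = ⁺-last rs

  ⁺-map : ∀ {S : Rel A ℓ} → (∀ {x y} → R x y → S x y) → ∀ {x y} → TransClosure R x y → TransClosure S x y
  ⁺-map f [ r ]    = [ f r ]
  ⁺-map f (r ∷ rs) = f r ∷ ⁺-map f rs

  -- x = xs 0 R xs 1 R ⋯ R xs k R y, indexed as in the acyclicity axiom.
  ⁺⇒walk : ∀ {p} {P : A → Set p} → (∀ {x y} → R x y → P x) → ∀ {x y} → TransClosure R x y →
           Σ ℕ λ k → Σ (Fin (suc k) → A) λ xs →
             xs fzero ≡ x × (∀ i → P (xs i)) × (∀ i → R (xs (inject₁ i)) (xs (fsuc i))) × R (xs (fromℕ k)) y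
  ⁺⇒walk src {x} [ r ] = 0 , (λ _ → x) , refl , (λ _ → src r) , (λ ()) , r
  ⁺⇒walk {P = P} src {x} (r ∷ rs) with ⁺⇒walk src rs
  ... | k , xs , refl , onP , steps , end = suc k , x ∷ᵥ xs , refl , onP′ , steps′ , end
    where
    onP′ : ∀ i → P ((x ∷ᵥ xs) i)
    onP′ fzero    = src r
    onP′ (fsuc i) = onP i
    steps′ : ∀ i → R ((x ∷ᵥ xs) (inject₁ i)) (xs i)
    steps′ fzero    = r
    steps′ (fsuc i) = steps i

¬¬-decidable : ∀ {n} (P : POP n) → ¬ ¬ (∀ α y x → Dec (POP.rel P α y x))
¬¬-decidable P = ¬¬-map bySign (decide ⁻ ⊗ decide ⁺)
  where
  open POP P using (rel)
  open RawMonad ¬¬-Monad using (_⊗_; rawApplicative)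
  decide : ∀ α → ¬ ¬ (∀ y x → Dec (rel α y x))
  decide α = sequence rawApplicative λ y → sequence rawApplicative λ x → ¬¬-excluded-middle
  bySign : (∀ y x → Dec (rel ⁻ y x)) × (∀ y x → Dec (rel ⁺ y x)) → ∀ α y x → Dec (rel α y x)
  bySign (dec⁻ , dec⁺) ⁻ = dec⁻
  bySign (dec⁻ , dec⁺) ⁺ = dec⁺

neg-involutive : ∀ s → neg (neg s) ≡ s
neg-involutive ⁻ = refl
neg-involutive ⁺ = refl

s≢neg-s : ∀ s → s ≢ neg s
s≢neg-s ⁻ ()
s≢neg-s ⁺ ()

⁻·neg : ∀ s → ⁻ · neg s ≡ s
⁻·neg ⁻ = refl
⁻·neg ⁺ = refl

⁺·-identity : ∀ s → ⁺ · s ≡ s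
⁺·-identity ⁻ = refl
⁺·-identity ⁺ = refl

module Faces {n} (P : POP n) where
  open POP P

  sign-unique : ∀ {α β y x} → rel α y x → rel β y x → α ≡ β
  sign-unique {⁻} {⁻} _  _  = refl
  sign-unique {⁻} {⁺} r⁻ r⁺ = ⊥-elim (rel-excl _ _ r⁻ r⁺)
  sign-unique {⁺} {⁻} r⁺ r⁻ = ⊥-elim (rel-excl _ _ r⁻ r⁺)
  sign-unique {⁺} {⁺} _  _  = refl

  ⁻⇒¬⁺ : ∀ {y x} → rel ⁻ y x → ¬ rel ⁺ y x
  ⁻⇒¬⁺ = rel-excl _ _

  ⁺⇒¬⁻ : ∀ {y x} → rel ⁺ y x → ¬ rel ⁻ y x
  ⁺⇒¬⁻ r⁺ r⁻ = rel-excl _ _ r⁻ r⁺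

  dim-pos : ∀ {α y x} → rel α y x → dim x ≥ 1
  dim-pos {y = y} {x} r = subst (_≥ 1) (sym (rel-dim y x r)) (s≤s z≤n)

  γ-rel : ∀ x (h : dim x ≥ 1) → rel ⁺ (γ x h) x
  γ-rel x h = proj₁ (proj₂ (pos-exists x h))

  γ-unique : ∀ {v x} (h : dim x ≥ 1) → rel ⁺ v x → γ x h ≡ v
  γ-unique {v} {x} h r = sym (proj₂ (proj₂ (pos-exists x h)) v r)

  ⁺-unique : ∀ {v w x} → rel ⁺ v x → rel ⁺ w x → v ≡ w
  ⁺-unique r r′ = trans (sym (γ-unique (dim-pos r) r)) (γ-unique (dim-pos r) r′)

  dim-γ : ∀ x (h : dim x ≥ 1) → suc (dim (γ x h)) ≡ dim x
  dim-γ x h = sym (rel-dim _ x (γ-rel x h))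

  dim-≺ : ∀ {y x} → y ≺ x → dim y < dim x
  dim-≺ {y} {x} (_ , r) = ≤-reflexive (sym (rel-dim y x r))

  dim-mono : ∀ {y x} → y ≤ᶜ x → dim y ≤ dim x
  dim-mono ε          = ≤-refl
  dim-mono (r ◅ rest) = <⇒≤ (<-≤-trans (dim-≺ r) (dim-mono rest))

  _◁_ : Rel (Fin n) 0ℓ
  a ◁ b = Σ (Fin n) λ c → a ∈δ c × rel ⁺ b c

  ◁-dim : ∀ {a b} → a ◁ b → dim a ≡ dim b
  ◁-dim {a} {b} (c , a∈δc , b≺⁺c) = suc-injective (trans (sym (rel-dim a c a∈δc)) (rel-dim b c b≺⁺c))

  ◁⁺-dim : ∀ {a b} → TransClosure _◁_ a b → dim a ≡ dim b
  ◁⁺-dim [ r ]    = ◁-dim r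
  ◁⁺-dim (r ∷ rs) = trans (◁-dim r) (◁⁺-dim rs)

  <⁺⇒◁⁺ : ∀ {a b} → a <⁺ b → TransClosure _◁_ a b
  <⁺⇒◁⁺ = ⁺-map λ { (c , h , a∈δc , refl) → c , a∈δc , γ-rel c h }

  Between : Sign → Fin n → Fin n → Fin n → Set
  Between s v a x = Σ Sign λ β → Σ Sign λ α → rel β v a × rel α a x × α · β ≡ s

𝟙 : ∀ {a} {A : Set a} → Dec A → ℕ
𝟙 (yes _) = 1
𝟙 (no _)  = 0

𝟙-yes : ∀ {a} {A : Set a} (d : Dec A) → A → 𝟙 d ≡ 1
𝟙-yes (yes _) _ = refl
𝟙-yes (no ¬a) a = contradiction a ¬a

𝟙-no : ∀ {a} {A : Set a} (d : Dec A) → ¬ A → 𝟙 d ≡ 0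
𝟙-no (yes a) ¬a = contradiction a ¬a
𝟙-no (no _)  _  = refl

𝟙-positive : ∀ {a} {A : Set a} (d : Dec A) → 0 < 𝟙 d → A
𝟙-positive (yes a) _ = a

𝟙-mono : ∀ {a b} {A : Set a} {B : Set b} (d : Dec A) (e : Dec B) → (A → B) → 𝟙 d ≤ 𝟙 e
𝟙-mono (yes a) e f = ≤-reflexive (sym (𝟙-yes e (f a)))
𝟙-mono (no _)  e f = z≤n

𝟙-cong : ∀ {a b} {A : Set a} {B : Set b} (d : Dec A) (e : Dec B) → (A → B) → (B → A) → 𝟙 d ≡ 𝟙 e
𝟙-cong d e f g = ≤-antisym (𝟙-mono d e f) (𝟙-mono e d g)

-- Chains are ℕ-weighted formal sums of cells.  Boundaries are never subtracted: ∂M = ∂N is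
-- stated as ∂⁺M + ∂⁻N = ∂⁻M + ∂⁺N, and ∂M ≤ f − g as ∂⁺M + g ≤ ∂⁻M + f.
module Chains {n} (P : POP n) (rel? : ∀ α y x → Dec (POP.rel P α y x)) where
  open POP P
  open Faces P

  Chain : Set
  Chain = Fin n → ℕ

  𝟘 : Chain
  𝟘 _ = 0

  _⊕_ : Chain → Chain → Chain
  (M ⊕ N) a = M a + N a

  cell : Fin n → Chain
  cell c a = 𝟙 (a ≟ᶠ c)

  inputs output : Fin n → Chain
  inputs x a = 𝟙 (rel? ⁻ a x)
  output x a = 𝟙 (rel? ⁺ a x)

  𝟙-rel : ∀ {α y x} → rel α y x → 𝟙 (rel? α y x) ≡ 1
  𝟙-rel = 𝟙-yes (rel? _ _ _)

  𝟙-rel-neg : ∀ {α y x} → rel α y x → 𝟙 (rel? (neg α) y x) ≡ 0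
  𝟙-rel-neg {⁻} r = 𝟙-no (rel? ⁺ _ _) (⁻⇒¬⁺ r)
  𝟙-rel-neg {⁺} r = 𝟙-no (rel? ⁻ _ _) (⁺⇒¬⁻ r)

  ∂ : Sign → Chain → Fin n → ℕ
  ∂ α M v = ∑[ a < n ] (M a * 𝟙 (rel? α v a))

  ∂-⊕ : ∀ α M N v → ∂ α (M ⊕ N) v ≡ ∂ α M v + ∂ α N v
  ∂-⊕ α M N v = trans (sum-cong-≗ λ a → *-distribʳ-+ (𝟙 (rel? α v a)) (M a) (N a))
                      (∑-distrib-+ (λ a → M a * 𝟙 (rel? α v a)) (λ a → N a * 𝟙 (rel? α v a)))

  ∂-cong : ∀ α {M N} → M ≗ N → ∀ v → ∂ α M v ≡ ∂ α N v
  ∂-cong α M≗N v = sum-cong-≗ λ a → cong (_* 𝟙 (rel? α v a)) (M≗N a)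

  ∂-cell : ∀ α c v → ∂ α (cell c) v ≡ 𝟙 (rel? α v c)
  ∂-cell α c v = begin
    ∂ α (cell c) v                   ≡⟨ ∑-unique-positive _ c (λ a → 𝟙-positive (a ≟ᶠ c) ∘ proj₁ ∘ *-positive (cell c a)) ⟩
    cell c c * 𝟙 (rel? α v c)        ≡⟨ cong (_* 𝟙 (rel? α v c)) (𝟙-yes (c ≟ᶠ c) refl) ⟩
    1 * 𝟙 (rel? α v c)               ≡⟨ *-identityˡ _ ⟩
    𝟙 (rel? α v c)                   ∎
    where open ≡-Reasoning

  ∂⁻-positive : ∀ {M v} → 0 < ∂ ⁻ M v → Σ (Fin n) λ a → v ∈δ a × 0 < M a
  ∂⁻-positive {M} {v} pos with ∑-positive _ pos
  ... | a , posₐ = let (Mₐ>0 , v∈δa) = *-positive (M a) posₐ in a , 𝟙-positive (rel? ⁻ v a) v∈δa , Mₐ>0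

  term≤∂⁺ : ∀ M {v a} → rel ⁺ v a → M a ≤ ∂ ⁺ M v
  term≤∂⁺ M {v} {a} v≺⁺a = subst (_≤ ∂ ⁺ M v) (trans (cong (M a *_) (𝟙-rel v≺⁺a)) (*-identityʳ (M a)))
                                 (term≤∑ (λ b → M b * 𝟙 (rel? ⁺ v b)) a)

  output≗cell : ∀ {c x} → rel ⁺ c x → output x ≗ cell c
  output≗cell {c} {x} c≺⁺x a = 𝟙-cong (rel? ⁺ a x) (a ≟ᶠ c) (λ a≺⁺x → ⁺-unique a≺⁺x c≺⁺x) λ { refl → c≺⁺x }

  infix 4 _∼_ _∂≤_⊖_

  record _∼_ (M N : Chain) : Set where
    constructor mk∼
    field balance : ∀ v → ∂ ⁺ M v + ∂ ⁻ N v ≡ ∂ ⁻ M v + ∂ ⁺ N v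
  open _∼_ public

  record _∂≤_⊖_ (M f g : Chain) : Set where
    constructor mk∂≤
    field bound : ∀ v → ∂ ⁺ M v + g v ≤ ∂ ⁻ M v + f v
  open _∂≤_⊖_ public

  ∼-refl : ∀ M → M ∼ M
  ∼-refl M = mk∼ λ v → +-comm (∂ ⁺ M v) (∂ ⁻ M v)

  ≗⇒∼ : ∀ {M N} → M ≗ N → M ∼ N
  ≗⇒∼ {M} M≗N = mk∼ λ v → trans (cong (∂ ⁺ M v +_) (sym (∂-cong ⁻ M≗N v)))
                                (trans (balance (∼-refl M) v) (cong (∂ ⁻ M v +_) (∂-cong ⁺ M≗N v)))

  ∼-trans : ∀ {M N K} → M ∼ N → N ∼ K → M ∼ K
  ∼-trans {M} {N} M∼N N∼K = mk∼ λ v →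
    balanced-trans {∂ ⁺ M v} {∂ ⁻ M v} {∂ ⁺ N v} {∂ ⁻ N v} (balance M∼N v) (balance N∼K v)

  ∼-⊕ : ∀ {M M′ N N′} → M ∼ N → M′ ∼ N′ → M ⊕ M′ ∼ N ⊕ N′
  ∼-⊕ {M} {M′} {N} {N′} M∼N M′∼N′ = mk∼ λ v → begin
    ∂ ⁺ (M ⊕ M′) v + ∂ ⁻ (N ⊕ N′) v                 ≡⟨ cong₂ _+_ (∂-⊕ ⁺ M M′ v) (∂-⊕ ⁻ N N′ v) ⟩
    (∂ ⁺ M v + ∂ ⁺ M′ v) + (∂ ⁻ N v + ∂ ⁻ N′ v)     ≡⟨ interchange (∂ ⁺ M v) _ _ _ ⟩
    (∂ ⁺ M v + ∂ ⁻ N v) + (∂ ⁺ M′ v + ∂ ⁻ N′ v)     ≡⟨ cong₂ _+_ (balance M∼N v) (balance M′∼N′ v) ⟩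
    (∂ ⁻ M v + ∂ ⁺ N v) + (∂ ⁻ M′ v + ∂ ⁺ N′ v)     ≡⟨ interchange (∂ ⁻ M v) _ _ _ ⟩
    (∂ ⁻ M v + ∂ ⁻ M′ v) + (∂ ⁺ N v + ∂ ⁺ N′ v)     ≡⟨ cong₂ _+_ (∂-⊕ ⁻ M M′ v) (∂-⊕ ⁺ N N′ v) ⟨
    ∂ ⁻ (M ⊕ M′) v + ∂ ⁺ (N ⊕ N′) v                 ∎
    where open ≡-Reasoning

  ∼-∑ : ∀ {m} {M N : Fin m → Chain} → (∀ k → M k ∼ N k) →
        (λ a → ∑[ k < m ] M k a) ∼ (λ a → ∑[ k < m ] N k a)
  ∼-∑ {zero}  _   = ∼-refl 𝟘
  ∼-∑ {suc m} M∼N = ∼-⊕ (M∼N fzero) (∼-∑ (M∼N ∘ fsuc))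

  ∼cell⇒∂≤ : ∀ {M c} → M ∼ cell c → M ∂≤ output c ⊖ inputs c
  ∼cell⇒∂≤ {M} {c} M∼c = mk∂≤ λ v → ≤-reflexive (begin
    ∂ ⁺ M v + inputs c v              ≡⟨ cong (∂ ⁺ M v +_) (∂-cell ⁻ c v) ⟨
    ∂ ⁺ M v + ∂ ⁻ (cell c) v          ≡⟨ balance M∼c v ⟩
    ∂ ⁻ M v + ∂ ⁺ (cell c) v          ≡⟨ cong (∂ ⁻ M v +_) (∂-cell ⁺ c v) ⟩
    ∂ ⁻ M v + output c v              ∎)
    where open ≡-Reasoning

  ∂≤-mono : ∀ {M f f′ g g′} → (∀ v → f v ≤ f′ v) → (∀ v → g′ v ≤ g v) → M ∂≤ f ⊖ g → M ∂≤ f′ ⊖ g′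
  ∂≤-mono {M} f≤f′ g′≤g M∂≤ = mk∂≤ λ v →
    ≤-trans (+-monoʳ-≤ (∂ ⁺ M v) (g′≤g v)) (≤-trans (bound M∂≤ v) (+-monoʳ-≤ (∂ ⁻ M v) (f≤f′ v)))

  ∂≤-⊕ : ∀ {M M′ f f′ g g′} → M ∂≤ f ⊖ g → M′ ∂≤ f′ ⊖ g′ → M ⊕ M′ ∂≤ f ⊕ f′ ⊖ g ⊕ g′
  ∂≤-⊕ {M} {M′} {f} {f′} {g} {g′} M∂≤ M′∂≤ = mk∂≤ λ v → begin
    ∂ ⁺ (M ⊕ M′) v + (g v + g′ v)              ≡⟨ cong (_+ (g v + g′ v)) (∂-⊕ ⁺ M M′ v) ⟩
    (∂ ⁺ M v + ∂ ⁺ M′ v) + (g v + g′ v)        ≡⟨ interchange (∂ ⁺ M v) _ _ _ ⟩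
    (∂ ⁺ M v + g v) + (∂ ⁺ M′ v + g′ v)        ≤⟨ +-mono-≤ (bound M∂≤ v) (bound M′∂≤ v) ⟩
    (∂ ⁻ M v + f v) + (∂ ⁻ M′ v + f′ v)        ≡⟨ interchange (∂ ⁻ M v) _ _ _ ⟩
    (∂ ⁻ M v + ∂ ⁻ M′ v) + (f v + f′ v)        ≡⟨ cong (_+ (f v + f′ v)) (∂-⊕ ⁻ M M′ v) ⟨
    ∂ ⁻ (M ⊕ M′) v + (f v + f′ v)              ∎
    where open ≤-Reasoning

  ∂≤-cancel : ∀ {M f g h} → M ∂≤ f ⊕ h ⊖ g ⊕ h → M ∂≤ f ⊖ g
  ∂≤-cancel {M} {f} {g} {h} M∂≤ = mk∂≤ λ v → +-cancelʳ-≤ (h v) (∂ ⁺ M v + g v) (∂ ⁻ M v + f v)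
    (subst₂ _≤_ (sym (+-assoc _ (g v) (h v))) (sym (+-assoc _ (f v) (h v))) (bound M∂≤ v))

  ∂≤-at : ∀ {M f g} v → M ∂≤ f ⊖ g → f v ≡ 0 → g v ≤ ∂ ⁻ M v
  ∂≤-at {M} {f} {g} v M∂≤ fv≡0 =
    m+n≤o⇒n≤o (∂ ⁺ M v) (subst (∂ ⁺ M v + g v ≤_) (trans (cong (∂ ⁻ M v +_) fv≡0) (+-identityʳ _)) (bound M∂≤ v))

  Supported : Fin n → Chain → Set
  Supported Z M = ∀ {a} → 0 < M a → a ∈δ Z

  Supported-⊕ : ∀ {Z M N} → Supported Z M → Supported Z N → Supported Z (M ⊕ N)
  Supported-⊕ {M = M} sM sN pos with +-positive {M _} pos
  ... | inj₁ posM = sM posM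
  ... | inj₂ posN = sN posN

  Expansion : Fin n → Chain → Set
  Expansion Z N = Σ Chain λ M → Supported Z M × M ∼ N

  expansion-cell : ∀ {Z c} → c ∈δ Z → Expansion Z (cell c)
  expansion-cell {c = c} c∈δZ = cell c , (λ {a} pos → subst (_∈δ _) (sym (𝟙-positive (a ≟ᶠ c) pos)) c∈δZ) , ∼-refl (cell c)

  expansion-𝟘 : ∀ {Z} → Expansion Z 𝟘
  expansion-𝟘 = 𝟘 , (λ ()) , ∼-refl 𝟘

  expansion-∼ : ∀ {Z N N′} → Expansion Z N → N ∼ N′ → Expansion Z N′
  expansion-∼ (M , sM , M∼N) N∼N′ = M , sM , ∼-trans M∼N N∼N′

  expansion-∑ : ∀ {Z m} {N : Fin m → Chain} → (∀ k → Expansion Z (N k)) → Expansion Z (λ a → ∑[ k < m ] N k a)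
  expansion-∑ {Z} {m} {N} exp = (λ a → ∑[ k < m ] proj₁ (exp k) a) , supported , ∼-∑ (proj₂ ∘ proj₂ ∘ exp)
    where
    supported : ∀ {a} → 0 < ∑[ k < m ] proj₁ (exp k) a → a ∈δ Z
    supported pos = let (k , posₖ) = ∑-positive _ pos in proj₁ (proj₂ (exp k)) posₖ

module Dendritic {n} (P : POP n) (D : IsDendritic P) (rel? : ∀ α y x → Dec (POP.rel P α y x)) where
  open POP P
  open IsDendritic D
  open Faces P
  open Chains P rel?

  between-unique : ∀ {s v a b x} → Between s v a x → Between s v b x → a ≡ b
  between-unique {v = v} {a} {b} {x} (β , α , v≺a , a≺x , refl) (β′ , α′ , v≺b , b≺x , α′β′≡αβ) with a ≟ᶠ b
  ... | yes a≡b = a≡b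
  ... | no a≢b with thin x a v v≺a a≺x
  ... | a₁ , _ , (β₁ , α₁ , v≺a₁ , a₁≺x , αβ≡-α₁β₁) , others with others b (a≢b ∘ sym) (β′ , v≺b) (α′ , b≺x)
  ... | refl with sign-unique v≺b v≺a₁ | sign-unique b≺x a₁≺x
  ... | refl | refl = ⊥-elim (s≢neg-s (α · β) (trans αβ≡-α₁β₁ (cong neg α′β′≡αβ)))

  between-flip : ∀ {s v a x} → Between s v a x → Σ (Fin n) λ a′ → Between (neg s) v a′ x
  between-flip {v = v} {a} {x} (β , α , v≺a , a≺x , refl) with thin x a v v≺a a≺x
  ... | a′ , _ , (β′ , α′ , v≺a′ , a′≺x , αβ≡-α′β′) , _ =
    a′ , β′ , α′ , v≺a′ , a′≺x , trans (sym (neg-involutive (α′ · β′))) (cong neg (sym αβ≡-α′β′))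

  -- The number (0 or 1) of paths v ≺^β a ≺^α x through a with α · β = s.
  paths : Sign → Fin n → Fin n → Fin n → ℕ
  paths s v x a = inputs x a * 𝟙 (rel? (neg s) v a) + output x a * 𝟙 (rel? s v a)

  paths-one : ∀ {s v a x} → Between s v a x → paths s v x a ≡ 1
  paths-one {v = v} {a} (⁻ , ⁻ , v≺a , a≺x , refl) =
    cong₂ _+_ (cong₂ _*_ (𝟙-rel a≺x) (𝟙-rel v≺a)) (cong (_* 𝟙 (rel? ⁺ v a)) (𝟙-rel-neg a≺x))
  paths-one {v = v} {a} (⁺ , ⁻ , v≺a , a≺x , refl) =
    cong₂ _+_ (cong₂ _*_ (𝟙-rel a≺x) (𝟙-rel v≺a)) (cong (_* 𝟙 (rel? ⁻ v a)) (𝟙-rel-neg a≺x))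
  paths-one {v = v} {a} (⁻ , ⁺ , v≺a , a≺x , refl) =
    cong₂ _+_ (cong (_* 𝟙 (rel? ⁺ v a)) (𝟙-rel-neg a≺x)) (cong₂ _*_ (𝟙-rel a≺x) (𝟙-rel v≺a))
  paths-one {v = v} {a} (⁺ , ⁺ , v≺a , a≺x , refl) =
    cong₂ _+_ (cong (_* 𝟙 (rel? ⁻ v a)) (𝟙-rel-neg a≺x)) (cong₂ _*_ (𝟙-rel a≺x) (𝟙-rel v≺a))

  paths-positive : ∀ {s v a x} → 0 < paths s v x a → Between s v a x
  paths-positive {s} {v} {a} {x} pos with +-positive {inputs x a * 𝟙 (rel? (neg s) v a)} pos
  ... | inj₁ pos⁻ = let (a∈δx , v≺a) = *-positive (inputs x a) pos⁻ in
    neg s , ⁻ , 𝟙-positive (rel? (neg s) v a) v≺a , 𝟙-positive (rel? ⁻ a x) a∈δx , ⁻·neg s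
  ... | inj₂ pos⁺ = let (a≺x , v≺a) = *-positive (output x a) pos⁺ in
    s , ⁺ , 𝟙-positive (rel? s v a) v≺a , 𝟙-positive (rel? ⁺ a x) a≺x , ⁺·-identity s

  ∑-paths≡1 : ∀ {s v a x} → Between s v a x → ∑[ b < n ] paths s v x b ≡ 1
  ∑-paths≡1 {a = a} between = trans (∑-unique-positive _ a λ b pos → between-unique (paths-positive pos) between)
                                    (paths-one between)

  ∑-paths≡0 : ∀ {s v x} → (∀ a → ¬ Between s v a x) → ∑[ a < n ] paths s v x a ≡ 0
  ∑-paths≡0 none = ≯0⇒≡0 λ pos → let (a , posₐ) = ∑-positive _ pos in none a (paths-positive posₐ)

  paths-balanced : ∀ v x → ∑[ a < n ] paths ⁻ v x a ≡ ∑[ a < n ] paths ⁺ v x a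
  paths-balanced v x with any? (λ a → 0 <? paths ⁻ v x a)
  ... | yes (a , pos) = let between = paths-positive pos in
    trans (∑-paths≡1 between) (sym (∑-paths≡1 (proj₂ (between-flip between))))
  ... | no none = trans (∑-paths≡0 λ a between → none (a , ≤-reflexive (sym (paths-one between))))
    (sym (∑-paths≡0 λ a between → let (a′ , between′) = between-flip between in
                                    none (a′ , ≤-reflexive (sym (paths-one between′)))))

  -- ∂∂x = 0: oriented thinness pairs off the two-step paths v ≺ a ≺ x with opposite sign products.
  inputs∼output : ∀ x → inputs x ∼ output x
  inputs∼output x = mk∼ λ v → begin
    ∂ ⁺ (inputs x) v + ∂ ⁻ (output x) v  ≡⟨ ∑-distrib-+ (λ a → inputs x a * 𝟙 (rel? ⁺ v a)) (λ a → output x a * 𝟙 (rel? ⁻ v a)) ⟨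
    ∑[ a < n ] paths ⁻ v x a             ≡⟨ paths-balanced v x ⟩
    ∑[ a < n ] paths ⁺ v x a             ≡⟨ ∑-distrib-+ (λ a → inputs x a * 𝟙 (rel? ⁻ v a)) (λ a → output x a * 𝟙 (rel? ⁺ v a)) ⟩
    ∂ ⁻ (inputs x) v + ∂ ⁺ (output x) v  ∎
    where open ≡-Reasoning

  expansion-output : ∀ {Z c x} → rel ⁺ c x → (∀ k → k ∈δ x → Expansion Z (cell k)) → Expansion Z (cell c)
  expansion-output {Z} {c} {x} c≺⁺x expand =
    expansion-∼ (expansion-∑ expand-input)
                (∼-trans (≗⇒∼ ∑-inputs) (∼-trans (inputs∼output x) (≗⇒∼ (output≗cell c≺⁺x))))
    where
    expand-input : ∀ k → Expansion Z (λ a → inputs x k * cell k a)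
    expand-input k with rel? ⁻ k x
    ... | yes k∈δx = expansion-∼ (expand k k∈δx) (≗⇒∼ λ a → sym (+-identityʳ (cell k a)))
    ... | no _     = expansion-𝟘
    ∑-inputs : (λ a → ∑[ k < n ] (inputs x k * cell k a)) ≗ inputs x
    ∑-inputs a = trans (∑-unique-positive _ a λ k pos → sym (𝟙-positive (a ≟ᶠ k) (proj₂ (*-positive (inputs x k) pos))))
                       (trans (cong (inputs x a *_) (𝟙-yes (a ≟ᶠ a) refl)) (*-identityʳ (inputs x a)))

  top : Fin n
  top = proj₁ greatest

  dim≤top : ∀ x → dim x ≤ dim top
  dim≤top x = dim-mono (proj₂ greatest x)

  top-unique : ∀ {x} → dim x ≡ dim top → x ≡ top
  top-unique {x} eq with proj₂ greatest x
  ... | ε        = refl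
  ... | r ◅ rest = contradiction eq (<⇒≢ (<-≤-trans (dim-≺ r) (dim-mono rest)))

  coface : ∀ {c} → dim c < dim top → Σ (Fin n) (c ≺_)
  coface {c} lt with proj₂ greatest c
  ... | ε     = contradiction lt (<-irrefl refl)
  ... | r ◅ _ = _ , r

  IsOutput : Fin n → Set
  IsOutput c = Σ (Fin n) (rel ⁺ c)

  Covered : Fin n → Set
  Covered Z = ∀ c → suc (dim c) ≡ dim Z → c ∈δ Z ⊎ IsOutput c

  Expansions : Fin n → Set
  Expansions Z = ∀ c → suc (dim c) ≡ dim Z → Expansion Z (cell c)

  Unlinked : ℕ → Set
  Unlinked L = ∀ {d e e′} → dim e ≡ L → e ∈δ d → e′ ∈δ d → ¬ TransClosure _◁_ e e′

  covered-top : Covered top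
  covered-top c dc with coface (≤-reflexive dc)
  ... | x , ⁻ , c∈δx = inj₁ (subst (c ∈δ_) (top-unique (trans (rel-dim c x c∈δx) dc)) c∈δx)
  ... | x , ⁺ , c≺⁺x = inj₂ (x , c≺⁺x)

  unlinked-top : ∀ {L} → suc L ≡ dim top → Unlinked L
  unlinked-top eq {d} {e} {e′} refl e∈δd e′∈δd path with ⁺-last path
  ... | _ , c , _ , e′≺⁺c = ⁺⇒¬⁻ e′≺⁺c (subst (e′ ∈δ_) (trans d≡top (sym c≡top)) e′∈δd)
    where
    d≡top : d ≡ top
    d≡top = top-unique (trans (rel-dim e d e∈δd) eq)
    c≡top : c ≡ top
    c≡top = top-unique (trans (rel-dim e′ c e′≺⁺c) (trans (cong suc (sym (◁⁺-dim path))) eq))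

  -- By the expansion of its coface, such a c lies in an input a of Z; thinness at c ≺⁻ a ≺⁻ Z
  -- then puts it in δ(γ Z).
  ¬output⇒∈δγ : ∀ {Z c} (h : dim Z ≥ 1) → Expansions Z → suc (dim c) ≡ dim (γ Z h) → ¬ IsOutput c → c ∈δ γ Z h
  ¬output⇒∈δγ {Z} {c} h expand dc ¬output = via-coface (coface c<top)
    where
    dZ : suc (suc (dim c)) ≡ dim Z
    dZ = trans (cong suc dc) (dim-γ Z h)
    c<top : dim c < dim top
    c<top = ≤-trans (n≤1+n _) (subst (_≤ dim top) (sym dZ) (dim≤top Z))
    via-input : ∀ {a} → c ∈δ a → a ∈δ Z → c ∈δ γ Z h
    via-input {a} c∈δa a∈δZ with thin Z a c c∈δa a∈δZ
    ... | y , _ , (⁻ , ⁺ , c∈δy , y≺⁺Z , _) , _ = subst (c ∈δ_) (sym (γ-unique h y≺⁺Z)) c∈δy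
    ... | y , _ , (⁺ , _ , c≺⁺y , _) , _      = contradiction (y , c≺⁺y) ¬output
    ... | _ , _ , (⁻ , ⁻ , _ , _ , ()) , _
    via-coface : Σ (Fin n) (c ≺_) → c ∈δ γ Z h
    via-coface (x , ⁺ , c≺⁺x) = contradiction (x , c≺⁺x) ¬output
    via-coface (x , ⁻ , c∈δx) =
      let (M , supported , M∼x) = expand x (trans (cong suc (rel-dim c x c∈δx)) dZ)
          c∈δx≤∂⁻ = ∂≤-at c (∼cell⇒∂≤ M∼x) (𝟙-rel-neg c∈δx)
          (a , c∈δa , Ma>0) = ∂⁻-positive {M} (subst (_≤ ∂ ⁻ M c) (𝟙-rel c∈δx) c∈δx≤∂⁻)
      in via-input c∈δa (supported Ma>0)

  covered-γ : ∀ {Z} (h : dim Z ≥ 1) → Expansions Z → Covered (γ Z h)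
  covered-γ h expand c dc with any? (λ x → rel? ⁺ c x)
  ... | yes output = inj₂ output
  ... | no ¬output = inj₁ (¬output⇒∈δγ h expand dc ¬output)

  UpperAt : ℕ → Rel (Fin n) 0ℓ
  UpperAt L a b = dim a ≡ L × a ◁ b

  upperAt-wellFounded : ∀ {L} → Unlinked L → WellFounded (UpperAt L)
  upperAt-wellFounded unlinked = acyclic⇒wellFounded λ cycle →
    let (_ , dim≡L , _ , x∈δc , _) = ⁺-head cycle in unlinked dim≡L x∈δc x∈δc (⁺-map proj₂ cycle)

  -- Induction along upper paths, well-founded by Unlinked L: an output of x is expanded through the inputs of x.
  expansions : ∀ {Z L} → suc L ≡ dim Z → Covered Z → Unlinked L → Expansions Z
  expansions {Z} {L} dZ covered unlinked c dc = expand (upperAt-wellFounded unlinked c) (suc-injective (trans dc (sym dZ)))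
    where
    expand : ∀ {c} → Acc (UpperAt L) c → dim c ≡ L → Expansion Z (cell c)
    expand {c} (acc rec) dim≡L with covered c (trans (cong suc dim≡L) dZ)
    ... | inj₁ c∈δZ       = expansion-cell c∈δZ
    ... | inj₂ (x , c≺⁺x) = expansion-output c≺⁺x λ k k∈δx →
      let dk = trans (◁-dim (x , k∈δx , c≺⁺x)) dim≡L in expand (rec (dk , x , k∈δx , c≺⁺x)) dk

  module Flow {Z : Fin n} {L : ℕ} (dZ : dim Z ≡ suc (suc L)) where

    input-pos : ∀ {a} → a ∈δ Z → dim a ≥ 1
    input-pos {a} a∈δZ = subst (_≥ 1) (suc-injective (trans (sym dZ) (rel-dim a Z a∈δZ))) (s≤s z≤n)

    _follows_ : Rel (Fin n) 0ℓ
    b follows a = b ∈δ Z × a ∈δ Z × Σ (Fin n) λ v → rel ⁺ v a × v ∈δ b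

    γ∈δ-follower : ∀ {a b} → b follows a → (h : dim a ≥ 1) → γ a h ∈δ b
    γ∈δ-follower {b = b} (_ , _ , v , v≺⁺a , v∈δb) h = subst (_∈δ b) (sym (γ-unique h v≺⁺a)) v∈δb

    follows-acyclic : ∀ {a} → ¬ TransClosure _follows_ a a
    follows-acyclic cycle with ⁺⇒walk proj₁ cycle
    ... | k , as , refl , as∈δZ , steps , last =
      acyclic Z (subst (_≥ 1) (sym dZ) (s≤s z≤n)) k as as∈δZ (input-pos ∘ as∈δZ)
        ((λ i → γ∈δ-follower (steps i) _) , γ∈δ-follower last _)

    follows-wellFounded : WellFounded _follows_
    follows-wellFounded = acyclic⇒wellFounded follows-acyclic

    ∂⁻-input : ∀ {M v} → Supported Z M → 0 < ∂ ⁻ M v → Σ (Fin n) λ a → v ∈δ a × a ∈δ Z × ∂ ⁻ M v ≡ M a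
    ∂⁻-input {M} {v} supported pos with ∂⁻-positive {M} pos
    ... | a , v∈δa , Ma>0 = a , v∈δa , supported Ma>0 , trans (∑-unique-positive _ a unique) value
      where
      unique : ∀ b → 0 < M b * 𝟙 (rel? ⁻ v b) → b ≡ a
      unique b pos′ = let (Mb>0 , v∈δb) = *-positive (M b) pos′ in
        between-unique (⁻ , ⁻ , 𝟙-positive (rel? ⁻ v b) v∈δb , supported Mb>0 , refl)
                       (⁻ , ⁻ , v∈δa , supported Ma>0 , refl)
      value : M a * 𝟙 (rel? ⁻ v a) ≡ M a
      value = trans (cong (M a *_) (𝟙-rel v∈δa)) (*-identityʳ (M a))

    follower-with-mass : ∀ {M a v k} → Supported Z M → 0 < k → a ∈δ Z → rel ⁺ v a → k ≤ ∂ ⁻ M v →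
              Σ (Fin n) λ b → b follows a × k ≤ M b
    follower-with-mass {M} {v = v} supported k>0 a∈δZ v≺⁺a k≤∂⁻ with ∂⁻-input {M} supported (<-≤-trans k>0 k≤∂⁻)
    ... | b , v∈δb , b∈δZ , ∂⁻≡Mb = b , (b∈δZ , a∈δZ , v , v≺⁺a , v∈δb) , subst (_ ≤_) ∂⁻≡Mb k≤∂⁻

    mass≤∂⁻+E : ∀ {M E a v} → M ∂≤ E ⊖ 𝟘 → rel ⁺ v a → M a ≤ ∂ ⁻ M v + E v
    mass≤∂⁻+E {M} {v = v} M∂≤ v≺⁺a = ≤-trans (term≤∂⁺ M v≺⁺a) (≤-trans (m≤m+n (∂ ⁺ M v) 0) (bound M∂≤ v))

    -- Positive mass at a passes through the output of a, where ∂M ≤ 0, to a follower of a; since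
    -- _follows_ is well-founded this cannot go on forever.
    no-closed-flow : ∀ {M E} (Q : Fin n → Set) → Supported Z M → M ∂≤ E ⊖ 𝟘 →
                     (∀ {a b} → b follows a → Q a → Q b) → (∀ {a v} → Q a → rel ⁺ v a → E v ≡ 0) →
                     ∀ {a} → Q a → 0 < M a → ⊥
    no-closed-flow {M} {E} Q supported M∂≤ Q-closed E-vanishes {a} Qa Ma>0 = go (follows-wellFounded a) Qa Ma>0
      where
      go : ∀ {a} → Acc _follows_ a → Q a → 0 < M a → ⊥
      go {a} (acc rec) Qa Ma>0 =
        let a∈δZ = supported Ma>0
            v≺⁺a = γ-rel a (input-pos a∈δZ)
            Ma≤∂⁻ = subst (M a ≤_) (trans (cong (_ +_) (E-vanishes Qa v≺⁺a)) (+-identityʳ _)) (mass≤∂⁻+E M∂≤ v≺⁺a)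
            (b , b-follows-a , Mb>0) = follower-with-mass supported (s≤s z≤n) a∈δZ v≺⁺a (≤-trans Ma>0 Ma≤∂⁻)
        in go (rec b-follows-a) (Q-closed b-follows-a Qa) Mb>0

    -- Here ∂M may be 1 at the output of x: mass 2 loses at most one unit there, and afterwards the
    -- walk stays strictly after the unique input of Z with that output, where ∂M ≤ 0.
    no-double-flow : ∀ {M x} → Supported Z M → M ∂≤ output x ⊖ 𝟘 → ∀ {a} → 2 ≤ M a → ⊥
    no-double-flow {M} {x} supported M∂≤ {a} Ma≥2 = go (follows-wellFounded a) Ma≥2
      where
      go : ∀ {a} → Acc _follows_ a → 2 ≤ M a → ⊥
      go {a} (acc rec) Ma≥2 = through (rel? ⁺ v x)
        where
        a∈δZ : a ∈δ Z
        a∈δZ = supported (≤-trans (s≤s z≤n) Ma≥2)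
        v : Fin n
        v = γ a (input-pos a∈δZ)
        v≺⁺a : rel ⁺ v a
        v≺⁺a = γ-rel a (input-pos a∈δZ)
        Ma≤∂⁻ : M a ≤ ∂ ⁻ M v + output x v
        Ma≤∂⁻ = mass≤∂⁻+E M∂≤ v≺⁺a
        through : Dec (rel ⁺ v x) → ⊥
        through (yes v≺⁺x) =
          let (b , b-follows-a , Mb>0) = follower-with-mass supported (s≤s z≤n) a∈δZ v≺⁺a ∂⁻>0
          in no-closed-flow (λ u → TransClosure _follows_ u a) supported M∂≤ _∷_ never-back [ b-follows-a ] Mb>0
          where
          ∂⁻>0 : 0 < ∂ ⁻ M v
          ∂⁻>0 = +-cancelʳ-≤ 1 1 (∂ ⁻ M v) (≤-trans Ma≥2 (subst (M a ≤_) (cong (∂ ⁻ M v +_) (𝟙-rel v≺⁺x)) Ma≤∂⁻))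
          never-back : ∀ {b w} → TransClosure _follows_ b a → rel ⁺ w b → output x w ≡ 0
          never-back {b} {w} b-after-a w≺⁺b = 𝟙-no (rel? ⁺ w x) λ w≺⁺x →
            let b∈δZ = proj₁ (proj₂ (⁺-head b-after-a))
                w≺⁺a = subst (λ u → rel ⁺ u a) (⁺-unique v≺⁺x w≺⁺x) v≺⁺a
                b≡a  = between-unique (⁺ , ⁻ , w≺⁺b , b∈δZ , refl) (⁺ , ⁻ , w≺⁺a , a∈δZ , refl)
            in follows-acyclic (subst (λ u → TransClosure _follows_ u a) b≡a b-after-a)
        through (no v⊀⁺x) =
          let ∂⁻≥2 = ≤-trans Ma≥2 (subst (M a ≤_) (trans (cong (∂ ⁻ M v +_) (𝟙-no (rel? ⁺ v x) v⊀⁺x)) (+-identityʳ _)) Ma≤∂⁻)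
              (b , b-follows-a , Mb≥2) = follower-with-mass supported (s≤s z≤n) a∈δZ v≺⁺a ∂⁻≥2
          in go (rec b-follows-a) Mb≥2

    UpperChain : Fin n → Fin n → Set
    UpperChain u u′ = Σ Chain λ M → Supported Z M × M ∂≤ cell u′ ⊖ cell u × Σ (Fin n) λ a → 0 < M a

    module _ (expand : Expansions Z) where

      step-chain : ∀ {u u′} → dim u ≡ L → u ◁ u′ → UpperChain u u′
      step-chain {u} {u′} du (c , u∈δc , u′≺⁺c) = from-expansion (expand c dc)
        where
        dc : suc (dim c) ≡ dim Z
        dc = trans (cong suc (rel-dim u c u∈δc)) (trans (cong (suc ∘ suc) du) (sym dZ))
        u≤inputs : ∀ v → cell u v ≤ inputs c v
        u≤inputs v = 𝟙-mono (v ≟ᶠ u) (rel? ⁻ v c) λ { refl → u∈δc }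
        from-expansion : Expansion Z (cell c) → UpperChain u u′
        from-expansion (M , supported , M∼c) =
          let M∂≤ = ∼cell⇒∂≤ M∼c
              (a , _ , Ma>0) = ∂⁻-positive {M} (subst (_≤ ∂ ⁻ M u) (𝟙-rel u∈δc) (∂≤-at u M∂≤ (𝟙-rel-neg u∈δc)))
          in M , supported , ∂≤-mono (≤-reflexive ∘ output≗cell u′≺⁺c) u≤inputs M∂≤ , a , Ma>0

      path-chain : ∀ {u u′} → dim u ≡ L → TransClosure _◁_ u u′ → UpperChain u u′
      path-chain du [ s ] = step-chain du s
      path-chain {u} du (_∷_ {y = u₁} {u′} s rest) with step-chain du s | path-chain (trans (sym (◁-dim s)) du) rest
      ... | M₁ , supported₁ , ∂₁ , a , M₁a>0 | M₂ , supported₂ , ∂₂ , _ =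
        M₁ ⊕ M₂ , Supported-⊕ supported₁ supported₂ ,
        ∂≤-cancel {h = cell u₁} (∂≤-mono (λ v → ≤-reflexive (+-comm (cell u₁ v) (cell u′ v))) (λ _ → ≤-refl) (∂≤-⊕ ∂₁ ∂₂)) ,
        a , ≤-trans M₁a>0 (m≤m+n (M₁ a) (M₂ a))

      no-upper-cycle : ∀ {e} → dim e ≡ L → ¬ TransClosure _◁_ e e
      no-upper-cycle {e} de cycle with path-chain de cycle
      ... | M , supported , M∂≤ , a , Ma>0 =
        no-closed-flow (λ _ → ⊤) supported (∂≤-cancel {f = 𝟘} {g = 𝟘} {h = cell e} M∂≤) _ (λ _ _ → refl) tt Ma>0

      -- The chain of the path plus the expansion of d has boundary ≤ γd − 2e, so the input of Z
      -- containing e carries mass 2.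
      no-upper-path-between-distinct-inputs : ∀ {d e e′} → dim e ≡ L → e ∈δ d → e′ ∈δ d → e ≢ e′ → ¬ TransClosure _◁_ e e′
      no-upper-path-between-distinct-inputs {d} {e} {e′} de e∈δd e′∈δd e≢e′ path =
        double-mass (path-chain de path) (expand d dd)
        where
        dd : suc (dim d) ≡ dim Z
        dd = trans (cong suc (rel-dim e d e∈δd)) (trans (cong (suc ∘ suc) de) (sym dZ))
        both-inputs : ∀ v → cell e v + cell e′ v ≤ inputs d v
        both-inputs v with v ≟ᶠ e | v ≟ᶠ e′
        ... | yes refl | yes refl = contradiction refl e≢e′
        ... | yes refl | no _     = ≤-reflexive (sym (𝟙-rel e∈δd))
        ... | no _     | yes refl = ≤-reflexive (sym (𝟙-rel e′∈δd))
        ... | no _     | no _     = z≤n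
        double-mass : UpperChain e e′ → Expansion Z (cell d) → ⊥
        double-mass (P , supportedP , P∂≤ , _) (Md , supportedMd , Md∼d) =
          let (a , _ , _ , ∂⁻≡Ma) = ∂⁻-input {P ⊕ Md} supported (≤-trans (s≤s z≤n) ∂⁻≥2)
          in no-double-flow supported (∂≤-mono (λ _ → ≤-refl) (λ _ → z≤n) M∂≤) (subst (2 ≤_) ∂⁻≡Ma ∂⁻≥2)
          where
          supported : Supported Z (P ⊕ Md)
          supported = Supported-⊕ supportedP supportedMd
          M∂≤ : P ⊕ Md ∂≤ output d ⊖ cell e ⊕ cell e
          M∂≤ = ∂≤-cancel {h = cell e′} (∂≤-mono (λ v → ≤-reflexive (+-comm (cell e′ v) (output d v)))
                  (λ v → ≤-trans (≤-reflexive (+-assoc (cell e v) (cell e v) (cell e′ v))) (+-monoʳ-≤ (cell e v) (both-inputs v)))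
                  (∂≤-⊕ P∂≤ (∼cell⇒∂≤ Md∼d)))
          ∂⁻≥2 : 2 ≤ ∂ ⁻ (P ⊕ Md) e
          ∂⁻≥2 = subst (_≤ ∂ ⁻ (P ⊕ Md) e) (cong₂ _+_ (𝟙-yes (e ≟ᶠ e) refl) (𝟙-yes (e ≟ᶠ e) refl))
                       (∂≤-at e M∂≤ (𝟙-rel-neg e∈δd))

      unlinked-below : Unlinked L
      unlinked-below {e = e} {e′} de e∈δd e′∈δd with e ≟ᶠ e′
      ... | yes refl = no-upper-cycle de
      ... | no e≢e′  = no-upper-path-between-distinct-inputs de e∈δd e′∈δd e≢e′

  descend : ∀ j {L} → j + suc L ≡ dim top → Σ (Fin n) λ Z → dim Z ≡ suc L × Covered Z × Unlinked L
  descend zero    eq = top , sym eq , covered-top , unlinked-top eq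
  descend (suc j) {L} eq with descend j {suc L} (trans (+-suc j (suc L)) eq)
  ... | Z , dZ , covered , unlinked = γ Z h , suc-injective (trans (dim-γ Z h) dZ) , covered-γ h expand , Flow.unlinked-below dZ expand
    where
    h : dim Z ≥ 1
    h = subst (_≥ 1) (sym dZ) (s≤s z≤n)
    expand : Expansions Z
    expand = expansions (sym dZ) covered unlinked

  no-upper-path-between-inputs : ∀ {d e e′} → e ∈δ d → e′ ∈δ d → ¬ TransClosure _◁_ e e′
  no-upper-path-between-inputs {d} {e} e∈δd =
    let (_ , _ , _ , unlinked) = descend (dim top ∸ suc (dim e)) (m∸n+n≡m e<top) in unlinked refl e∈δd
    where
    e<top : suc (dim e) ≤ dim top
    e<top = subst (_≤ dim top) (rel-dim e d e∈δd) (dim≤top d)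

mainTheorem16 : ∀ {n : ℕ} (P : POP n) → IsDendritic P →
    ¬ (Σ (Fin n) λ d → Σ (Fin n) λ e → Σ (Fin n) λ e' →
         POP._∈δ_ P e d × POP._∈δ_ P e' d × POP._<⁺_ P e e')
mainTheorem16 P D (d , e , e′ , e∈δd , e′∈δd , e<⁺e′) = ¬¬-decidable P λ rel? →
  Dendritic.no-upper-path-between-inputs P D rel? e∈δd e′∈δd (Faces.<⁺⇒◁⁺ P e<⁺e′)
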